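{- Let $q\ge2$, $n$, $d$ be integers with $2\le d\le n$ and $d$ even. Then \[ \epsilon(n,d)>\begin{cases}-\dfrac{q^{n+d-1}+1}{q^{d-1}-1}&\text{for even }n,\\[1ex] \tfrac12q^{d-2}(q^{n-d+1}-1)&\text{for odd }n,\end{cases} \qquad \epsilon(n,d)<\begin{cases}-\dfrac{q^n}{q+1}&\text{for even }n,\\[1ex] \dfrac{q^{n+d-1}-1}{q^{d-1}-1}&\text{for odd }n.\end{cases} \]
   Context: For integers $q\ge2$, $n$, $d$, \[ \epsilon(n,d)=\frac{((-q)^{n-d+2}-1)+q\frac{(-q)^{n+d-2}-1}{q(-q)^{d-2}-1}((-q)^{n-d+1}-1)}{((-q)^{n-d+2}-1)+q\frac{(-q)^{n+d-2}-1}{(-q)^{n+d-1}-1}((-q)^{n-d+1}-1)}. \] -}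

module Defs where

open import Data.Nat as ℕ using (ℕ; zero; suc; _∸_)
open import Data.Rational using (ℚ; 0ℚ; 1ℚ; _+_; _*_; _-_; -_; _÷_; _≟_; ≢-nonZero)
open import Relation.Nullary using (yes; no)

infixr 8 _^_
_^_ : ℚ → ℕ → ℚ
x ^ zero = 1ℚ
x ^ suc n = x * (x ^ n)

-- total division; x / 0 := 0 (only used where the denominator is nonzero
-- under the statement's hypotheses)
infixl 7 _⊘_
_⊘_ : ℚ → ℚ → ℚ
x ⊘ y with y ≟ 0ℚ
... | yes _ = 0ℚ
... | no y≢0 = _÷_ x y {{≢-nonZero y≢0}}

-- ε(n,d) from the paper (with q given as a rational, exponents as
-- natural numbers; n-d+2 etc. are truncated subtraction, exact when 2 ≤ d ≤ n)
epsilon : ℚ → ℕ → ℕ → ℚ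
epsilon q n d =
  let mq = - q
      A  = mq ^ ((n ∸ d) ℕ.+ 2) - 1ℚ
      B  = mq ^ ((n ℕ.+ d) ∸ 2) - 1ℚ
      C  = mq ^ (suc n ∸ d) - 1ℚ
      num = A + q * (B ⊘ (q * mq ^ (d ∸ 2) - 1ℚ)) * C
      den = A + q * (B ⊘ (mq ^ ((n ℕ.+ d) ∸ 1) - 1ℚ)) * C
  in num ⊘ den

-- For even d, clearing the two inner denominators of ε(n,d) exposes a common factor -(w + 1), and
--   ε(n,d) = (q + 1 - w - s)(ws + 1) / ((s - 1)(q + 1)(w - 1)),   s = q^(d-1), w = (-q)^n.
-- Put v = q^n, so w = v for even n and w = -v for odd n. On the region 1 < q ≤ s, qs ≤ v each of the
-- four bounds, after cross-multiplying, is the positivity of a polynomial in q, s, v: three of these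
-- factor into evidently positive pieces, and the odd lower bound, written with X = v - s as
-- X(s-1)(v+1)(q+1) < (X+q+1)(vs-1)(2q), holds factor by factor.

module Submission where

open import Defs
open import Data.Nat as ℕ using (ℕ; suc; _∸_; _≤_)
open import Data.Nat.Divisibility using (_∣_)
open import Relation.Nullary using (¬_)
open import Data.Rational using (ℚ; 1ℚ; _+_; _*_; _-_; -_; _<_; ½; _/_)
open import Data.Integer using (+_)
open import Data.Product using (_×_)

open import Data.Nat using (zero; s≤s; z≤n)
import Data.Nat.Properties as ℕ
open import Data.Nat.Divisibility using (∣m+n∣m⇒∣n; ∣m∣n⇒∣m+n; ∣-refl; ∣1⇒≡1; _∣0)
import Data.Nat.Coprimality as Coprime
import Data.Integer as ℤ using (_<_; +<+)
import Data.Integer.Properties as ℤ using (*-identityʳ)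
open import Data.Rational using (0ℚ; _≟_; 1/_; positive; nonNegative; *<*)
import Data.Rational as ℚ using (_≤_)
open import Data.Rational.Base using (≢-nonZero)
open import Data.Rational.Properties
  using ( +-*-commutativeRing; *-assoc; *-comm; *-identityˡ; *-identityʳ; *-zeroˡ; *-inverseˡ; *-inverseʳ
        ; +-identityʳ; +-inverseʳ; neg-injective; neg-distribˡ-*
        ; ≤-refl; ≤-trans; <⇒≤; <-irrefl; <-trans; <-≤-trans; <-respˡ-≡
        ; +-monoʳ-<; +-monoˡ-<; +-monoʳ-≤; +-monoˡ-≤; *-monoˡ-<-pos; *-monoˡ-≤-nonNeg; *-cancelʳ-<-nonNeg
        ; positive⁻¹; nonNegative⁻¹; pos*pos⇒pos; pos+pos⇒pos; pos+nonNeg⇒pos; nonNeg*nonNeg⇒nonNeg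
        ; normalize-coprime )
open import Data.Product using (_,_; map₁)
open import Data.List using (_∷_; [])
open import Relation.Nullary using (yes; no; contradiction)
open import Relation.Nullary.Decidable.Core using (dec⇒maybe; toSum)
open import Data.Sum using (inj₁; inj₂)
open import Relation.Binary.PropositionalEquality
open import Tactic.RingSolver using (solve-∀; solve)
open import Tactic.RingSolver.Core.AlmostCommutativeRing using (AlmostCommutativeRing; fromCommutativeRing)
open import Level using (0ℓ)
open ≡-Reasoning

ℚ-ring : AlmostCommutativeRing 0ℓ 0ℓ
ℚ-ring = fromCommutativeRing +-*-commutativeRing (λ x → dec⇒maybe (0ℚ ≟ x))

0<1 : 0ℚ < 1ℚ
0<1 = positive⁻¹ 1ℚ

pos⇒≢0 : ∀ {p} → 0ℚ < p → p ≢ 0ℚ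
pos⇒≢0 0<p p≡0 = <-irrefl (sym p≡0) 0<p

neg-≢0 : ∀ {p} → p ≢ 0ℚ → - p ≢ 0ℚ
neg-≢0 p≢0 -p≡0 = p≢0 (neg-injective -p≡0)

*-pos : ∀ {p q} → 0ℚ < p → 0ℚ < q → 0ℚ < p * q
*-pos {p} {q} 0<p 0<q = positive⁻¹ _ {{pos*pos⇒pos p {{positive 0<p}} q {{positive 0<q}}}}

*-nonNeg : ∀ {p q} → 0ℚ ℚ.≤ p → 0ℚ ℚ.≤ q → 0ℚ ℚ.≤ p * q
*-nonNeg {p} {q} 0≤p 0≤q =
  nonNegative⁻¹ _ {{nonNeg*nonNeg⇒nonNeg p {{nonNegative 0≤p}} q {{nonNegative 0≤q}}}}

+-pos : ∀ {p q} → 0ℚ < p → 0ℚ < q → 0ℚ < p + q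
+-pos {p} {q} 0<p 0<q = positive⁻¹ _ {{pos+pos⇒pos p {{positive 0<p}} q {{positive 0<q}}}}

+-pos-nonNeg : ∀ {p q} → 0ℚ < p → 0ℚ ℚ.≤ q → 0ℚ < p + q
+-pos-nonNeg {p} {q} 0<p 0≤q = positive⁻¹ _ {{pos+nonNeg⇒pos p {{positive 0<p}} q {{nonNegative 0≤q}}}}

p<q⇒0<q-p : ∀ {p q} → p < q → 0ℚ < q - p
p<q⇒0<q-p {p} {q} p<q = subst (_< q - p) (+-inverseʳ p) (+-monoˡ-< (- p) p<q)

p≤q⇒0≤q-p : ∀ {p q} → p ℚ.≤ q → 0ℚ ℚ.≤ q - p
p≤q⇒0≤q-p {p} {q} p≤q = subst (ℚ._≤ q - p) (+-inverseʳ p) (+-monoˡ-≤ (- p) p≤q)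

p+[q-p]≡q : ∀ p q → p + (q - p) ≡ q
p+[q-p]≡q = solve-∀ ℚ-ring

gap⇒< : ∀ {p q e} → q - p ≡ e → 0ℚ < e → p < q
gap⇒< {p} {q} refl 0<q-p = subst₂ _<_ (+-identityʳ p) (p+[q-p]≡q p q) (+-monoʳ-< p 0<q-p)

gap⇒≤ : ∀ {p q e} → q - p ≡ e → 0ℚ ℚ.≤ e → p ℚ.≤ q
gap⇒≤ {p} {q} refl 0≤q-p = subst₂ ℚ._≤_ (+-identityʳ p) (p+[q-p]≡q p q) (+-monoʳ-≤ p 0≤q-p)

1<p⇒-p+1≢0 : ∀ {p} → 1ℚ < p → - p + 1ℚ ≢ 0ℚ
1<p⇒-p+1≢0 {p} 1<p -p+1≡0 = <-irrefl (sym p≡1) 1<p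
  where
  p≡1 : p ≡ 1ℚ
  p≡1 = begin
    p                   ≡⟨ solve (p ∷ []) ℚ-ring ⟩
    1ℚ - (- p + 1ℚ)     ≡⟨ cong (λ x → 1ℚ - x) -p+1≡0 ⟩
    1ℚ - 0ℚ             ≡⟨⟩
    1ℚ                  ∎

p<p+q : ∀ p {q} → 0ℚ < q → p < p + q
p<p+q p 0<q = subst (_< p + _) (+-identityʳ p) (+-monoʳ-< p 0<q)

p≤p*q : ∀ {p q} → 0ℚ ℚ.≤ p → 1ℚ ℚ.≤ q → p ℚ.≤ p * q
p≤p*q {p} 0≤p 1≤q = subst (ℚ._≤ p * _) (*-identityʳ p) (*-monoˡ-≤-nonNeg p {{nonNegative 0≤p}} 1≤q)

p<q*p : ∀ {p q} → 0ℚ < p → 1ℚ < q → p < q * p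
p<q*p {p} {q} 0<p 1<q = subst (_< q * p) (*-identityˡ p) (*-monoˡ-<-pos p {{positive 0<p}} 1<q)

*-mono-<-≤ : ∀ {p q r s} → 0ℚ ℚ.≤ p → p < q → 0ℚ < r → r ℚ.≤ s → p * r < q * s
*-mono-<-≤ {p} {q} {r} 0≤p p<q 0<r r≤s =
  <-≤-trans (*-monoˡ-<-pos r {{positive 0<r}} p<q)
            (*-monoˡ-≤-nonNeg q {{nonNegative (≤-trans 0≤p (<⇒≤ p<q))}} r≤s)

1<+n/1 : ∀ {n} → 2 ≤ n → 1ℚ < + n / 1
1<+n/1 {n} 2≤n rewrite normalize-coprime {n} {0} (Coprime.sym (Coprime.1-coprimeTo n)) =
  *<* (subst (+ 1 ℤ.<_) (sym (ℤ.*-identityʳ (+ n))) (ℤ.+<+ 2≤n))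

^-+ : ∀ x m n → x ^ (m ℕ.+ n) ≡ x ^ m * x ^ n
^-+ x zero    n = sym (*-identityˡ (x ^ n))
^-+ x (suc m) n = trans (cong (x *_) (^-+ x m n)) (sym (*-assoc x (x ^ m) (x ^ n)))

^-+-∸ : ∀ x m {n k} → k ≤ n → x ^ ((m ℕ.+ n) ∸ k) ≡ x ^ m * x ^ (n ∸ k)
^-+-∸ x m k≤n = trans (cong (x ^_) (ℕ.+-∸-assoc m k≤n)) (^-+ x m _)

^-split : ∀ x {m n} → m ≤ n → x ^ n ≡ x ^ m * x ^ (n ∸ m)
^-split x {m} m≤n = trans (cong (x ^_) (sym (ℕ.m+[n∸m]≡n m≤n))) (^-+ x m _)

1≤^ : ∀ {x} → 1ℚ ℚ.≤ x → ∀ n → 1ℚ ℚ.≤ x ^ n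
1≤^ 1≤x zero    = ≤-refl
1≤^ 1≤x (suc n) = ≤-trans 1≤x (p≤p*q (≤-trans (<⇒≤ 0<1) 1≤x) (1≤^ 1≤x n))

x≤x^n : ∀ {x} → 1ℚ ℚ.≤ x → ∀ {n} → 0 ℕ.< n → x ℚ.≤ x ^ n
x≤x^n 1≤x {suc n} _ = p≤p*q (≤-trans (<⇒≤ 0<1) 1≤x) (1≤^ 1≤x n)

neg-^-even : ∀ x {n} → 2 ∣ n → (- x) ^ n ≡ x ^ n
neg-^-even x {zero}        _     = refl
neg-^-even x {suc zero}    2∣1   = contradiction (∣1⇒≡1 2∣1) λ ()
neg-^-even x {suc (suc n)} 2∣2+n = begin
  (- x) * ((- x) * (- x) ^ n)  ≡⟨ cong (λ y → (- x) * ((- x) * y)) (neg-^-even x (∣m+n∣m⇒∣n 2∣2+n ∣-refl)) ⟩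
  (- x) * ((- x) * x ^ n)      ≡⟨ neg-neg x (x ^ n) ⟩
  x * (x * x ^ n)              ∎
  where
  neg-neg : ∀ x y → (- x) * ((- x) * y) ≡ x * (x * y)
  neg-neg = solve-∀ ℚ-ring

neg-^-odd : ∀ x {n} → ¬ 2 ∣ n → (- x) ^ n ≡ - (x ^ n)
neg-^-odd x {zero}        2∤0   = contradiction (2 ∣0) 2∤0
neg-^-odd x {suc zero}    _     = sym (neg-distribˡ-* x 1ℚ)
neg-^-odd x {suc (suc n)} 2∤2+n = begin
  (- x) * ((- x) * (- x) ^ n)   ≡⟨ cong (λ y → (- x) * ((- x) * y)) (neg-^-odd x 2∤n) ⟩
  (- x) * ((- x) * - (x ^ n))   ≡⟨ neg-neg-neg x (x ^ n) ⟩
  - (x * (x * x ^ n))           ∎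
  where
  2∤n : ¬ 2 ∣ n
  2∤n 2∣n = 2∤2+n (∣m∣n⇒∣m+n ∣-refl 2∣n)
  neg-neg-neg : ∀ x y → (- x) * ((- x) * - y) ≡ - (x * (x * y))
  neg-neg-neg = solve-∀ ℚ-ring

⊘-unique : ∀ {x y z} → y ≢ 0ℚ → z * y ≡ x → x ⊘ y ≡ z
⊘-unique {y = y} {z} y≢0 refl with y ≟ 0ℚ
... | yes y≡0 = contradiction y≡0 y≢0
... | no  y≢0 = begin
  z * y * 1/ y    ≡⟨ *-assoc z y (1/ y) ⟩
  z * (y * 1/ y)  ≡⟨ cong (z *_) (*-inverseʳ y) ⟩
  z * 1ℚ          ≡⟨ *-identityʳ z ⟩
  z               ∎
  where instance _ = ≢-nonZero y≢0

x⊘y*y≡x : ∀ x {y} → y ≢ 0ℚ → (x ⊘ y) * y ≡ x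
x⊘y*y≡x x {y} y≢0 with y ≟ 0ℚ
... | yes y≡0 = contradiction y≡0 y≢0
... | no  y≢0 = begin
  x * 1/ y * y    ≡⟨ *-assoc x (1/ y) y ⟩
  x * (1/ y * y)  ≡⟨ cong (x *_) (*-inverseˡ y) ⟩
  x * 1ℚ          ≡⟨ *-identityʳ x ⟩
  x               ∎
  where instance _ = ≢-nonZero y≢0

*-≢0 : ∀ {x y} → x ≢ 0ℚ → y ≢ 0ℚ → x * y ≢ 0ℚ
*-≢0 {x} {y} x≢0 y≢0 xy≡0 = x≢0 (begin
  x            ≡⟨ sym (⊘-unique y≢0 refl) ⟩
  (x * y) ⊘ y  ≡⟨ cong (_⊘ y) xy≡0 ⟩
  0ℚ ⊘ y       ≡⟨ ⊘-unique y≢0 (*-zeroˡ y) ⟩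
  0ℚ           ∎)

-- Splitting on toSum (y ≟ 0ℚ) rather than on y ≟ 0ℚ keeps the with from also
-- abstracting the zero test inside the x ⊘ y of the goal.
*-⊘-cancelʳ : ∀ x y {k} → k ≢ 0ℚ → (x * k) ⊘ (y * k) ≡ x ⊘ y
*-⊘-cancelʳ x y {k} k≢0 with toSum (y ≟ 0ℚ)
... | inj₁ refl = cong ((x * k) ⊘_) (*-zeroˡ k)
... | inj₂ y≢0  = ⊘-unique (*-≢0 y≢0 k≢0) (begin
  (x ⊘ y) * (y * k)  ≡⟨ sym (*-assoc (x ⊘ y) y k) ⟩
  (x ⊘ y) * y * k    ≡⟨ cong (_* k) (x⊘y*y≡x x y≢0) ⟩
  x * k              ∎)

neg-distribˡ-⊘ : ∀ x y → - (x ⊘ y) ≡ (- x) ⊘ y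
neg-distribˡ-⊘ x y with toSum (y ≟ 0ℚ)
... | inj₁ refl = refl
... | inj₂ y≢0  = sym (⊘-unique y≢0 (begin
  - (x ⊘ y) * y    ≡⟨ sym (neg-distribˡ-* (x ⊘ y) y) ⟩
  - ((x ⊘ y) * y)  ≡⟨ cong -_ (x⊘y*y≡x x y≢0) ⟩
  - x              ∎))

⊘-<-⊘ : ∀ {a b c d} → 0ℚ < b → 0ℚ < d → a * d < c * b → a ⊘ b < c ⊘ d
⊘-<-⊘ {a} {b} {c} {d} 0<b 0<d ad<cb =
  *-cancelʳ-<-nonNeg (b * d) {{nonNegative (<⇒≤ (*-pos 0<b 0<d))}} (subst₂ _<_ ad≡ cb≡ ad<cb)
  where
  ad≡ : a * d ≡ (a ⊘ b) * (b * d)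
  ad≡ = begin
    a * d              ≡⟨ cong (_* d) (sym (x⊘y*y≡x a (pos⇒≢0 0<b))) ⟩
    (a ⊘ b) * b * d    ≡⟨ *-assoc (a ⊘ b) b d ⟩
    (a ⊘ b) * (b * d)  ∎
  cb≡ : c * b ≡ (c ⊘ d) * (b * d)
  cb≡ = begin
    c * b              ≡⟨ cong (_* b) (sym (x⊘y*y≡x c (pos⇒≢0 0<d))) ⟩
    (c ⊘ d) * d * b    ≡⟨ *-assoc (c ⊘ d) d b ⟩
    (c ⊘ d) * (d * b)  ≡⟨ cong ((c ⊘ d) *_) (*-comm d b) ⟩
    (c ⊘ d) * (b * d)  ∎

-- epsilon q n d unfolds to epsilonOfPowers q applied to (-q)^(n-d+2), (-q)^(n+d-2),
-- (-q)^(n-d+1), (-q)^(d-2) and (-q)^(n+d-1).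
epsilonOfPowers : ℚ → ℚ → ℚ → ℚ → ℚ → ℚ → ℚ
epsilonOfPowers q p₁ p₂ p₃ p₄ p₅ =
  (p₁ - 1ℚ + q * ((p₂ - 1ℚ) ⊘ (q * p₄ - 1ℚ)) * (p₃ - 1ℚ)) ⊘
  (p₁ - 1ℚ + q * ((p₂ - 1ℚ) ⊘ (p₅ - 1ℚ)) * (p₃ - 1ℚ))

epsilonOfPowers-cong : ∀ {q p₁ p₁′ p₂ p₂′ p₃ p₃′ p₄ p₄′ p₅ p₅′} →
  p₁ ≡ p₁′ → p₂ ≡ p₂′ → p₃ ≡ p₃′ → p₄ ≡ p₄′ → p₅ ≡ p₅′ →
  epsilonOfPowers q p₁ p₂ p₃ p₄ p₅ ≡ epsilonOfPowers q p₁′ p₂′ p₃′ p₄′ p₅′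
epsilonOfPowers-cong refl refl refl refl refl = refl

closedNum closedDen : ℚ → ℚ → ℚ → ℚ
closedNum q s w = (q + 1ℚ - w - s) * (w * s + 1ℚ)
closedDen q s w = (s - 1ℚ) * (q + 1ℚ) * (w - 1ℚ)

clear-⊘ : ∀ A q B C {y} → y ≢ 0ℚ → (A + q * (B ⊘ y) * C) * y ≡ A * y + q * B * C
clear-⊘ A q B C {y} y≢0 = begin
  (A + q * (B ⊘ y) * C) * y      ≡⟨ distrib A q (B ⊘ y) C y ⟩
  A * y + q * ((B ⊘ y) * y) * C  ≡⟨ cong (λ z → A * y + q * z * C) (x⊘y*y≡x B y≢0) ⟩
  A * y + q * B * C              ∎
  where
  distrib : ∀ A q X C y → (A + q * X * C) * y ≡ A * y + q * (X * y) * C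
  distrib = solve-∀ ℚ-ring

epsilonOfPowers-closedForm : ∀ q a r {w} → let s = q * r in w ≡ a * q * q * r →
  s - 1ℚ ≢ 0ℚ → w * s + 1ℚ ≢ 0ℚ → w + 1ℚ ≢ 0ℚ →
  epsilonOfPowers q (a * q * q) (w * r) (- q * a) r (- (w * s)) ≡ closedNum q s w ⊘ closedDen q s w
epsilonOfPowers-closedForm q a r refl s-1≢0 ws+1≢0 w+1≢0 = begin
  num ⊘ den                          ≡⟨ sym (*-⊘-cancelʳ num den (*-≢0 s-1≢0 -ws-1≢0)) ⟩
  (num * (α * β)) ⊘ (den * (α * β))  ≡⟨ cong₂ _⊘_ num-cleared den-cleared ⟩
  (closedNum q s w * k) ⊘ (closedDen q s w * k)
                                     ≡⟨ *-⊘-cancelʳ (closedNum q s w) (closedDen q s w) (neg-≢0 w+1≢0) ⟩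
  closedNum q s w ⊘ closedDen q s w  ∎
  where
  s = q * r
  w = a * q * q * r
  A = a * q * q - 1ℚ
  B = w * r - 1ℚ
  C = - q * a - 1ℚ
  α = s - 1ℚ
  β = - (w * s) - 1ℚ
  k = - (w + 1ℚ)
  num = A + q * (B ⊘ α) * C
  den = A + q * (B ⊘ β) * C
  -ws-1≢0 : β ≢ 0ℚ
  -ws-1≢0 = subst (_≢ 0ℚ) (neg-sum (w * s)) (neg-≢0 ws+1≢0)
    where
    neg-sum : ∀ x → - (x + 1ℚ) ≡ - x - 1ℚ
    neg-sum = solve-∀ ℚ-ring
  num-identity : ∀ q a r → let s = q * r ; w = a * q * q * r in
    ((a * q * q - 1ℚ) * (s - 1ℚ) + q * (w * r - 1ℚ) * (- q * a - 1ℚ)) * (- (w * s) - 1ℚ)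
      ≡ (q + 1ℚ - w - s) * (w * s + 1ℚ) * (- (w + 1ℚ))
  num-identity = solve-∀ ℚ-ring
  den-identity : ∀ q a r → let s = q * r ; w = a * q * q * r in
    ((a * q * q - 1ℚ) * (- (w * s) - 1ℚ) + q * (w * r - 1ℚ) * (- q * a - 1ℚ)) * (s - 1ℚ)
      ≡ (s - 1ℚ) * (q + 1ℚ) * (w - 1ℚ) * (- (w + 1ℚ))
  den-identity = solve-∀ ℚ-ring
  num-cleared : num * (α * β) ≡ closedNum q s w * k
  num-cleared = begin
    num * (α * β)               ≡⟨ sym (*-assoc num α β) ⟩
    num * α * β                 ≡⟨ cong (_* β) (clear-⊘ A q B C s-1≢0) ⟩
    (A * α + q * B * C) * β     ≡⟨ num-identity q a r ⟩
    closedNum q s w * k         ∎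
  den-cleared : den * (α * β) ≡ closedDen q s w * k
  den-cleared = begin
    den * (α * β)               ≡⟨ cong (den *_) (*-comm α β) ⟩
    den * (β * α)               ≡⟨ sym (*-assoc den β α) ⟩
    den * β * α                 ≡⟨ cong (_* α) (clear-⊘ A q B C -ws-1≢0) ⟩
    (A * β + q * B * C) * α     ≡⟨ den-identity q a r ⟩
    closedDen q s w * k         ∎

epsilon≡closedForm : ∀ q n t {w} → 2 ℕ.+ t ≤ n → 2 ∣ t → (- q) ^ n ≡ w →
  let s = q ^ suc t in s - 1ℚ ≢ 0ℚ → w * s + 1ℚ ≢ 0ℚ → w + 1ℚ ≢ 0ℚ →
  epsilon q n (2 ℕ.+ t) ≡ closedNum q s w ⊘ closedDen q s w
epsilon≡closedForm q n t d≤n 2∣t refl s-1≢0 ws+1≢0 w+1≢0 =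
  trans (epsilonOfPowers-cong {q = q} p₁≡ p₂≡ p₃≡ r′≡r p₅≡)
        (epsilonOfPowers-closedForm q a r w≡ s-1≢0 ws+1≢0 w+1≢0)
  where
  m = n ∸ (2 ℕ.+ t)
  a = (- q) ^ m
  r = q ^ t
  w = (- q) ^ n
  r′≡r : (- q) ^ t ≡ r
  r′≡r = neg-^-even q 2∣t
  w≡ : w ≡ a * q * q * r
  w≡ = begin
    (- q) ^ n                    ≡⟨ ^-split (- q) d≤n ⟩
    (- q) * ((- q) * (- q) ^ t) * a  ≡⟨ cong (λ x → (- q) * ((- q) * x) * a) r′≡r ⟩
    (- q) * ((- q) * r) * a      ≡⟨ reorder q r a ⟩
    a * q * q * r                ∎
    where
    reorder : ∀ q r a → (- q) * ((- q) * r) * a ≡ a * q * q * r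
    reorder = solve-∀ ℚ-ring
  p₁≡ : (- q) ^ (m ℕ.+ 2) ≡ a * q * q
  p₁≡ = trans (^-+ (- q) m 2) (square a q)
    where
    square : ∀ a q → a * ((- q) * ((- q) * 1ℚ)) ≡ a * q * q
    square = solve-∀ ℚ-ring
  p₂≡ : (- q) ^ ((n ℕ.+ (2 ℕ.+ t)) ∸ 2) ≡ w * r
  p₂≡ = trans (^-+-∸ (- q) n (s≤s (s≤s z≤n))) (cong (w *_) r′≡r)
  p₃≡ : (- q) ^ (suc n ∸ (2 ℕ.+ t)) ≡ - q * a
  p₃≡ = cong ((- q) ^_) (ℕ.+-∸-assoc 1 d≤n)
  p₅≡ : (- q) ^ ((n ℕ.+ (2 ℕ.+ t)) ∸ 1) ≡ - (w * (q * r))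
  p₅≡ = begin
    (- q) ^ ((n ℕ.+ (2 ℕ.+ t)) ∸ 1) ≡⟨ ^-+-∸ (- q) n (s≤s z≤n) ⟩
    w * ((- q) * (- q) ^ t)         ≡⟨ cong (λ x → w * ((- q) * x)) r′≡r ⟩
    w * ((- q) * r)                 ≡⟨ pull-neg w q r ⟩
    - (w * (q * r))                 ∎
    where
    pull-neg : ∀ w q r → w * ((- q) * r) ≡ - (w * (q * r))
    pull-neg = solve-∀ ℚ-ring

module Region {q s v : ℚ} (1<q : 1ℚ < q) (q≤s : q ℚ.≤ s) (qs≤v : q * s ℚ.≤ v) where

  0<q : 0ℚ < q
  0<q = <-trans 0<1 1<q

  1<s : 1ℚ < s
  1<s = <-≤-trans 1<q q≤s

  0<s : 0ℚ < s
  0<s = <-trans 0<1 1<s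

  s<v : s < v
  s<v = <-≤-trans (p<q*p 0<s 1<q) qs≤v

  1<v : 1ℚ < v
  1<v = <-trans 1<s s<v

  0<v : 0ℚ < v
  0<v = <-trans 0<1 1<v

  1<vs : 1ℚ < v * s
  1<vs = <-trans 1<v (subst (v <_) (*-comm s v) (p<q*p 0<v 1<s))

  0<q+1 : 0ℚ < q + 1ℚ
  0<q+1 = +-pos 0<q 0<1

  0<s-1 : 0ℚ < s - 1ℚ
  0<s-1 = p<q⇒0<q-p 1<s

  0<v-1 : 0ℚ < v - 1ℚ
  0<v-1 = p<q⇒0<q-p 1<v

  0<v+1 : 0ℚ < v + 1ℚ
  0<v+1 = +-pos 0<v 0<1

  0<vs+1 : 0ℚ < v * s + 1ℚ
  0<vs+1 = +-pos (<-trans 0<1 1<vs) 0<1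

  0<vs-1 : 0ℚ < v * s - 1ℚ
  0<vs-1 = p<q⇒0<q-p 1<vs

  0<v-s : 0ℚ < v - s
  0<v-s = p<q⇒0<q-p s<v

even-bounds : ∀ {q s v} → 1ℚ < q → q ℚ.≤ s → q * s ℚ.≤ v →
  - ((v * s + 1ℚ) ⊘ (s - 1ℚ)) < closedNum q s v ⊘ closedDen q s v ×
  closedNum q s v ⊘ closedDen q s v < - (v ⊘ (q + 1ℚ))
even-bounds {q} {s} {v} 1<q q≤s qs≤v =
    subst (_< ε) (sym (neg-distribˡ-⊘ (v * s + 1ℚ) (s - 1ℚ))) lower
  , subst (ε <_) (sym (neg-distribˡ-⊘ v (q + 1ℚ))) upper
  where
  open Region 1<q q≤s qs≤v
  0<den : 0ℚ < closedDen q s v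
  0<den = *-pos (*-pos 0<s-1 0<q+1) 0<v-1
  0<qv-s : 0ℚ < q * v - s
  0<qv-s = p<q⇒0<q-p (<-trans s<v (p<q*p 0<v 1<q))
  lower-gap : (q + 1ℚ - v - s) * (v * s + 1ℚ) * (s - 1ℚ) - (- (v * s + 1ℚ)) * ((s - 1ℚ) * (q + 1ℚ) * (v - 1ℚ))
            ≡ (s - 1ℚ) * (v * s + 1ℚ) * (q * v - s)
  lower-gap = solve (q ∷ s ∷ v ∷ []) ℚ-ring
  upper-gap : (- v) * ((s - 1ℚ) * (q + 1ℚ) * (v - 1ℚ)) - (q + 1ℚ - v - s) * (v * s + 1ℚ) * (q + 1ℚ)
            ≡ (q + 1ℚ) * ((v - 1ℚ) * (v + 1ℚ) + (v * s + 1ℚ) * (s - q))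
  upper-gap = solve (q ∷ s ∷ v ∷ []) ℚ-ring
  ε = closedNum q s v ⊘ closedDen q s v
  lower : (- (v * s + 1ℚ)) ⊘ (s - 1ℚ) < ε
  lower = ⊘-<-⊘ 0<s-1 0<den (gap⇒< lower-gap (*-pos (*-pos 0<s-1 0<vs+1) 0<qv-s))
  upper : ε < (- v) ⊘ (q + 1ℚ)
  upper = ⊘-<-⊘ 0<den 0<q+1 (gap⇒< upper-gap
    (*-pos 0<q+1 (+-pos-nonNeg (*-pos 0<v-1 0<v+1) (*-nonNeg (<⇒≤ 0<vs+1) (p≤q⇒0≤q-p q≤s)))))

odd-bounds : ∀ {q s v} → 1ℚ < q → q ℚ.≤ s → q * s ℚ.≤ v →
  (v - s) ⊘ (q + q) < closedNum q s (- v) ⊘ closedDen q s (- v) ×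
  closedNum q s (- v) ⊘ closedDen q s (- v) < (v * s - 1ℚ) ⊘ (s - 1ℚ)
odd-bounds {q} {s} {v} 1<q q≤s qs≤v =
  subst (λ ε → (v - s) ⊘ (q + q) < ε × ε < (v * s - 1ℚ) ⊘ (s - 1ℚ)) (sym ε≡) (lower , upper)
  where
  open Region 1<q q≤s qs≤v
  num = (q + 1ℚ + v - s) * (v * s - 1ℚ)
  den = (s - 1ℚ) * (q + 1ℚ) * (v + 1ℚ)
  0<den : 0ℚ < den
  0<den = *-pos (*-pos 0<s-1 0<q+1) 0<v+1
  flip-num : (q + 1ℚ - (- v) - s) * ((- v) * s + 1ℚ) * (- 1ℚ) ≡ (q + 1ℚ + v - s) * (v * s - 1ℚ)
  flip-num = solve (q ∷ s ∷ v ∷ []) ℚ-ring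
  flip-den : (s - 1ℚ) * (q + 1ℚ) * ((- v) - 1ℚ) * (- 1ℚ) ≡ (s - 1ℚ) * (q + 1ℚ) * (v + 1ℚ)
  flip-den = solve (q ∷ s ∷ v ∷ []) ℚ-ring
  ε≡ : closedNum q s (- v) ⊘ closedDen q s (- v) ≡ num ⊘ den
  ε≡ = trans (sym (*-⊘-cancelʳ (closedNum q s (- v)) (closedDen q s (- v)) λ ())) (cong₂ _⊘_ flip-num flip-den)
  [s-1][v+1]≤vs-1 : (s - 1ℚ) * (v + 1ℚ) ℚ.≤ v * s - 1ℚ
  [s-1][v+1]≤vs-1 = gap⇒≤ gap (<⇒≤ 0<v-s)
    where
    gap : (v * s - 1ℚ) - (s - 1ℚ) * (v + 1ℚ) ≡ v - s
    gap = solve (s ∷ v ∷ []) ℚ-ring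
  factorwise : (v - s) * ((s - 1ℚ) * (v + 1ℚ)) * (q + 1ℚ) < (v - s + (q + 1ℚ)) * (v * s - 1ℚ) * (q + q)
  factorwise =
    *-mono-<-≤ (*-nonNeg (<⇒≤ 0<v-s) (<⇒≤ 0<[s-1][v+1]))
      (*-mono-<-≤ (<⇒≤ 0<v-s) (p<p+q (v - s) 0<q+1) 0<[s-1][v+1] [s-1][v+1]≤vs-1)
      0<q+1 (+-monoʳ-≤ q (<⇒≤ 1<q))
    where
    0<[s-1][v+1] = *-pos 0<s-1 0<v+1
  lhs≡ : (v - s) * ((s - 1ℚ) * (v + 1ℚ)) * (q + 1ℚ) ≡ (v - s) * ((s - 1ℚ) * (q + 1ℚ) * (v + 1ℚ))
  lhs≡ = solve (q ∷ s ∷ v ∷ []) ℚ-ring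
  rhs≡ : (v - s + (q + 1ℚ)) * (v * s - 1ℚ) * (q + q) ≡ (q + 1ℚ + v - s) * (v * s - 1ℚ) * (q + q)
  rhs≡ = solve (q ∷ s ∷ v ∷ []) ℚ-ring
  lower : (v - s) ⊘ (q + q) < num ⊘ den
  lower = ⊘-<-⊘ (+-pos 0<q 0<q) 0<den (subst₂ _<_ lhs≡ rhs≡ factorwise)
  upper-gap : (v * s - 1ℚ) * ((s - 1ℚ) * (q + 1ℚ) * (v + 1ℚ)) - (q + 1ℚ + v - s) * (v * s - 1ℚ) * (s - 1ℚ)
            ≡ (s - 1ℚ) * (v * s - 1ℚ) * (q * v + s)
  upper-gap = solve (q ∷ s ∷ v ∷ []) ℚ-ring
  upper : num ⊘ den < (v * s - 1ℚ) ⊘ (s - 1ℚ)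
  upper = ⊘-<-⊘ 0<den 0<s-1 (gap⇒< upper-gap (*-pos (*-pos 0<s-1 0<vs-1) (+-pos (*-pos 0<q 0<v) 0<s)))

epsilon-bounds : ∀ {q} n d → 1ℚ < q → 2 ≤ d → d ≤ n → 2 ∣ d →
  let e = epsilon q n d in
  (2 ∣ n → (- ((q ^ ((n ℕ.+ d) ∸ 1) + 1ℚ) ⊘ (q ^ (d ∸ 1) - 1ℚ)) < e) × (e < - ((q ^ n) ⊘ (q + 1ℚ))))
  × (¬ (2 ∣ n) → (½ * (q ^ (d ∸ 2)) * (q ^ (suc n ∸ d) - 1ℚ) < e)
                 × (e < (q ^ ((n ℕ.+ d) ∸ 1) - 1ℚ) ⊘ (q ^ (d ∸ 1) - 1ℚ)))
epsilon-bounds {q} n (suc (suc t)) 1<q (s≤s (s≤s z≤n)) d≤n 2∣d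
  rewrite ^-+-∸ q n {suc (suc t)} (s≤s z≤n) | ^-split q (ℕ.<⇒≤ d≤n) =
    (λ 2∣n → bounds-resp (ε≡ (trans (neg-^-even q 2∣n) qⁿ≡v) (pos⇒≢0 0<vs+1) (pos⇒≢0 0<v+1))
                  (even-bounds 1<q q≤s qs≤v))
  , (λ 2∤n → bounds-resp (ε≡ (trans (neg-^-odd q 2∤n) (cong -_ qⁿ≡v)) -vs+1≢0 (1<p⇒-p+1≢0 1<v))
                  (map₁ (<-respˡ-≡ (sym half≡)) (odd-bounds 1<q q≤s qs≤v)))
  where
  r = q ^ t
  u = q ^ (n ∸ suc t)
  s = q * r
  v = s * u
  qⁿ≡v : q ^ n ≡ v
  qⁿ≡v = ^-split q (ℕ.<⇒≤ d≤n)
  q≤s : q ℚ.≤ s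
  q≤s = p≤p*q (<⇒≤ (<-trans 0<1 1<q)) (1≤^ (<⇒≤ 1<q) t)
  qs≤v : q * s ℚ.≤ v
  qs≤v = subst (ℚ._≤ v) (*-comm s q)
    (*-monoˡ-≤-nonNeg s {{nonNegative (≤-trans (<⇒≤ (<-trans 0<1 1<q)) q≤s)}}
      (x≤x^n (<⇒≤ 1<q) (ℕ.m<n⇒0<n∸m d≤n)))
  open Region 1<q q≤s qs≤v
  ε≡ : ∀ {w} → (- q) ^ n ≡ w → w * s + 1ℚ ≢ 0ℚ → w + 1ℚ ≢ 0ℚ →
       epsilon q n (suc (suc t)) ≡ closedNum q s w ⊘ closedDen q s w
  ε≡ w≡ = epsilon≡closedForm q n t d≤n (∣m+n∣m⇒∣n 2∣d ∣-refl) w≡ (pos⇒≢0 0<s-1)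
  -vs+1≢0 : (- v) * s + 1ℚ ≢ 0ℚ
  -vs+1≢0 = subst (λ x → x + 1ℚ ≢ 0ℚ) (neg-distribˡ-* v s) (1<p⇒-p+1≢0 1<vs)
  half≡ : ½ * r * (u - 1ℚ) ≡ (v - s) ⊘ (q + q)
  half≡ = sym (⊘-unique (pos⇒≢0 (+-pos 0<q 0<q)) (halve q r u))
    where
    halve : ∀ q r u → ½ * r * (u - 1ℚ) * (q + q) ≡ q * r * u - q * r
    halve = solve-∀ ℚ-ring
  bounds-resp : ∀ {lo hi x y} → x ≡ y → lo < y × y < hi → lo < x × x < hi
  bounds-resp refl bounds = bounds

lemma8p21 : (q : ℕ) (n d : ℕ) → 2 ≤ q → 2 ≤ d → d ≤ n → 2 ∣ d →
    let Q = + q / 1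
        e = epsilon Q n d
    in (2 ∣ n → (- ((Q ^ ((n ℕ.+ d) ∸ 1) + 1ℚ) ⊘ (Q ^ (d ∸ 1) - 1ℚ)) < e)
                 × (e < - ((Q ^ n) ⊘ (Q + 1ℚ))))
       × (¬ (2 ∣ n) → (½ * (Q ^ (d ∸ 2)) * (Q ^ (suc n ∸ d) - 1ℚ) < e)
                 × (e < (Q ^ ((n ℕ.+ d) ∸ 1) - 1ℚ) ⊘ (Q ^ (d ∸ 1) - 1ℚ)))
lemma8p21 q n d 2≤q = epsilon-bounds n d (1<+n/1 2≤q)
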